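{- Let $a$ be a weak composition with $\mathrm{sort}(a)=(n-k,1^k)$ for some integers $n\ge 1$ and $0\le k\le n-1$. Then $\kappa_a$ is multiplicity free.
   Context: A weak composition $a=(a_1,\dots,a_\ell)$ of length $\ell$ is a finite sequence of nonnegative integers; $\mathrm{sort}(a)$ is the partition obtained by deleting the zeros of $a$ and arranging the remaining parts in weakly decreasing order; $(n-k,1^k)$ denotes the partition with one part $n-k$ followed by $k$ parts equal to $1$. A diagram is a finite set of cells $(r,c)$ with $r,c$ positive integers (row $r$ from the bottom, column $c$ from the left). A Kohnert tableau of content $a$ is a diagram filled with positive integers, exactly $a_i$ cells containing $i$ for each $i$, such that: (i) for each $i$ there is exactly one $i$ in each of the columns $1,\dots,a_i$; (ii) every entry in row $r$ is at least $r$; (iii) for each $i$, the cells containing $i$ weakly descend from left to right; (iv) if $i<j$ appear in the same column with $i$ above $j$, then there is an $i$ in the column immediately to the right of the cell containing that $j$, in a row strictly above it. It is quasi-Yamanouchi if moreover (v) for each nonempty row $r$, either row $r$ contains an entry equal to $r$, or some cell of row $r+1$ lies weakly to the right of some cell of row $r$. Let $\mathrm{QKT}(a)$ be the set of quasi-Yamanouchi Kohnert tableaux of content $a$, and $\mathrm{wt}(T)$ the weak composition of length $\ell$ whose $r$-th part is the number of cells in row $r$ of $T$. The key polynomial $\kappa_a$ satisfies $\kappa_a=\sum_{T\in\mathrm{QKT}(a)}\mathfrak{F}_{\mathrm{wt}(T)}$, where $\mathfrak{F}_b$ is the fundamental slide polynomial. We say $\kappa_a$ is multiplicity free if distinct tableaux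 in $\mathrm{QKT}(a)$ have distinct weights. -}

module Defs where

open import Data.Nat using (ℕ; zero; suc; _≤_; _<_; _≤ᵇ_; _≡ᵇ_)
open import Data.Bool using (Bool; true; false; if_then_else_)
open import Data.List using (List; []; _∷_; _++_; map; length; replicate)
open import Data.List.Membership.Propositional using (_∈_)
open import Data.Product using (_×_; _,_; ∃; ∃-syntax; proj₁; proj₂)
open import Data.Sum using (_⊎_)
open import Relation.Binary.PropositionalEquality using (_≡_)

WeakComp : Set
WeakComp = List ℕ

dropZeros : List ℕ → List ℕ
dropZeros [] = []
dropZeros (zero ∷ xs) = dropZeros xs
dropZeros (suc x ∷ xs) = suc x ∷ dropZeros xs

insertDesc : ℕ → List ℕ → List ℕ
insertDesc x [] = x ∷ []
insertDesc x (y ∷ ys) = if y ≤ᵇ x then x ∷ y ∷ ys else y ∷ insertDesc x ys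

sortDesc : List ℕ → List ℕ
sortDesc [] = []
sortDesc (x ∷ xs) = insertDesc x (sortDesc xs)

sortWC : WeakComp → List ℕ
sortWC a = sortDesc (dropZeros a)

-- the hook partition (n-k, 1^k)  (used with k < n, so n ∸ k ≥ 1)
open import Data.Nat using (_∸_)
hook : ℕ → ℕ → List ℕ
hook n k = (n ∸ k) ∷ replicate k 1

-- A filling of content a (of length ℓ) is encoded as T : List (List ℕ),
-- where the i-th list (1-based) lists the rows of the cells containing i,
-- in columns 1, 2, ..., a_i respectively.  Condition (i) (exactly one i
-- in each of columns 1..a_i) is exactly the shape condition map length T ≡ a.
-- Distinct tableaux of content a correspond exactly to distinct such T.

Filling : Set
Filling = List (List ℕ)

-- a cell is (entry , column , row)
Cell : Set
Cell = ℕ × ℕ × ℕ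

cellsRow : ℕ → ℕ → List ℕ → List Cell
cellsRow i c [] = []
cellsRow i c (r ∷ rs) = (i , c , r) ∷ cellsRow i (suc c) rs

cellsFrom : ℕ → Filling → List Cell
cellsFrom i [] = []
cellsFrom i (x ∷ xs) = cellsRow i 1 x ++ cellsFrom (suc i) xs

cells : Filling → List Cell
cells T = cellsFrom 1 T

row : Cell → ℕ
row (_ , _ , r) = r

record IsKohnertTableau (a : WeakComp) (T : Filling) : Set where
  field
    shape     : map length T ≡ a
    rowPos    : ∀ {i c r} → (i , c , r) ∈ cells T → 1 ≤ r
    distinct  : ∀ {i j c r} → (i , c , r) ∈ cells T → (j , c , r) ∈ cells T → i ≡ j
    entryRow  : ∀ {i c r} → (i , c , r) ∈ cells T → r ≤ i
    descend   : ∀ {i c c' r r'} → (i , c , r) ∈ cells T → (i , c' , r') ∈ cells T →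
                c < c' → r' ≤ r
    condIV    : ∀ {i j c r s} → (i , c , r) ∈ cells T → (j , c , s) ∈ cells T →
                i < j → s < r → ∃[ r' ] ((i , suc c , r') ∈ cells T × s < r')

record IsQuasiYamanouchi (a : WeakComp) (T : Filling) : Set where
  field
    kohnert : IsKohnertTableau a T
    condV   : ∀ {i c r} → (i , c , r) ∈ cells T →
              (∃[ c' ] ((r , c' , r) ∈ cells T))
              ⊎ (∃[ j ] ∃[ d ] ∃[ j' ] ∃[ d' ]
                   ((j , d , r) ∈ cells T × (j' , d' , suc r) ∈ cells T × d ≤ d'))

countRow : ℕ → List Cell → ℕ
countRow r [] = 0
countRow r ((_ , _ , s) ∷ xs) = if r ≡ᵇ s then suc (countRow r xs) else countRow r xs

wtFrom : ℕ → ℕ → List Cell → List ℕ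
wtFrom r zero cs = []
wtFrom r (suc m) cs = countRow r cs ∷ wtFrom (suc r) m cs

wt : WeakComp → Filling → List ℕ
wt a T = wtFrom 1 (length a) (cells T)

MultiplicityFree : WeakComp → Set
MultiplicityFree a = ∀ T T' → IsQuasiYamanouchi a T → IsQuasiYamanouchi a T' →
                     wt a T ≡ wt a T' → T ≡ T'

-- When a has at most one part exceeding 1, a tableau in QKT(a) is a first column
-- together with the cells of the single long entry b in columns ≥ 2, and these weakly descend.
-- Condition (v) makes every nonempty row meet the first column, which meets each row at most
-- once; so the weight tells, row by row, whether the row meets the first column and how many
-- later cells of b it holds. Descent recovers the later cells of b from that multiset of rows.
-- The first-column rows then agree by induction on the entry: if i sits lower in T than in T',
-- the entry j occupying that row of T' cannot be smaller than i (induction and distinctness),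
-- nor larger (condition (iv) in T' would put an i in column 2 above that row, hence also in T,
-- contradicting descent in T).
module Submission where

open import Defs
open import Data.Nat using (ℕ; zero; suc; _+_; _∸_; _≤_; _<_; _≡ᵇ_; _≤ᵇ_; _≥_; _⊓_; z≤n; s≤s; _≤?_; _<?_)
open import Data.Nat.Properties
open import Data.Nat.Induction using (<-rec)
open import Algebra.Properties.CommutativeSemigroup +-commutativeSemigroup using (x∙yz≈y∙xz; interchange)
open import Data.Bool using (true; false; if_then_else_)
open import Data.Bool.Properties using (T-≡)
open import Data.List using (List; []; _∷_; _++_; map; length; replicate; take; drop; concatMap)
open import Data.List.Properties using (take++drop≡id; length-drop; ++-identityʳ; length-map; ∷-injective; ∷-injectiveˡ; ∷-injectiveʳ)
open import Data.List.Membership.Propositional using (_∈_; _∉_)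
open import Data.List.Membership.Propositional.Properties using (∈-++⁺ˡ; ∈-++⁺ʳ; ∈-++⁻)
open import Data.List.Relation.Binary.Subset.Propositional using (_⊆_)
open import Data.List.Relation.Unary.Any using (here; there)
open import Data.List.Relation.Unary.All as All using (All)
open import Data.List.Relation.Unary.AllPairs as AllPairs using (AllPairs; []; _∷_)
open import Data.Product using (_×_; _,_; ∃-syntax; proj₁; proj₂)
open import Data.Sum using (_⊎_; inj₁; inj₂)
open import Function using (_∘_; Equivalence)
open import Relation.Nullary using (¬_; yes; no; contradiction)
open import Relation.Binary.Definitions using (tri<; tri≈; tri>)
open import Relation.Binary.PropositionalEquality

isLong : ℕ → ℕ
isLong (suc (suc _)) = 1
isLong _ = 0

longParts : List ℕ → ℕ
longParts [] = 0
longParts (x ∷ xs) = isLong x + longParts xs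

longParts-dropZeros : ∀ xs → longParts (dropZeros xs) ≡ longParts xs
longParts-dropZeros [] = refl
longParts-dropZeros (zero ∷ xs) = longParts-dropZeros xs
longParts-dropZeros (suc x ∷ xs) = cong (isLong (suc x) +_) (longParts-dropZeros xs)

longParts-insertDesc : ∀ x ys → longParts (insertDesc x ys) ≡ isLong x + longParts ys
longParts-insertDesc x [] = refl
longParts-insertDesc x (y ∷ ys) with y ≤ᵇ x
... | true = refl
... | false = trans (cong (isLong y +_) (longParts-insertDesc x ys))
                    (x∙yz≈y∙xz (isLong y) (isLong x) (longParts ys))

longParts-sortDesc : ∀ xs → longParts (sortDesc xs) ≡ longParts xs
longParts-sortDesc [] = refl
longParts-sortDesc (x ∷ xs) =
  trans (longParts-insertDesc x (sortDesc xs)) (cong (isLong x +_) (longParts-sortDesc xs))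

longParts-replicate-1 : ∀ k → longParts (replicate k 1) ≡ 0
longParts-replicate-1 zero = refl
longParts-replicate-1 (suc k) = longParts-replicate-1 k

isLong≤1 : ∀ x → isLong x ≤ 1
isLong≤1 zero = z≤n
isLong≤1 (suc zero) = z≤n
isLong≤1 (suc (suc _)) = s≤s z≤n

longParts-hook≤1 : ∀ n k → longParts (hook n k) ≤ 1
longParts-hook≤1 n k = begin
  isLong (n ∸ k) + longParts (replicate k 1) ≡⟨ cong (isLong (n ∸ k) +_) (longParts-replicate-1 k) ⟩
  isLong (n ∸ k) + 0                         ≡⟨ +-identityʳ _ ⟩
  isLong (n ∸ k)                             ≤⟨ isLong≤1 (n ∸ k) ⟩
  1                                          ∎
  where open ≤-Reasoning

sortWC≡hook⇒longParts≤1 : ∀ a n k → sortWC a ≡ hook n k → longParts a ≤ 1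
sortWC≡hook⇒longParts≤1 a n k sorted = begin
  longParts a                       ≡⟨ longParts-dropZeros a ⟨
  longParts (dropZeros a)           ≡⟨ longParts-sortDesc (dropZeros a) ⟨
  longParts (sortWC a)              ≡⟨ cong longParts sorted ⟩
  longParts (hook n k)              ≤⟨ longParts-hook≤1 n k ⟩
  1                                 ∎
  where open ≤-Reasoning

≡ᵇ-true⇒≡ : ∀ {m n} → (m ≡ᵇ n) ≡ true → m ≡ n
≡ᵇ-true⇒≡ {m} {n} eq = ≡ᵇ⇒≡ m n (Equivalence.from T-≡ eq)

≡ᵇ-refl : ∀ n → (n ≡ᵇ n) ≡ true
≡ᵇ-refl n = Equivalence.to T-≡ (≡⇒≡ᵇ n n refl)

occurrences : ℕ → List ℕ → ℕ
occurrences r [] = 0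
occurrences r (x ∷ xs) = if r ≡ᵇ x then suc (occurrences r xs) else occurrences r xs

occurrences-++ : ∀ r xs ys → occurrences r (xs ++ ys) ≡ occurrences r xs + occurrences r ys
occurrences-++ r [] ys = refl
occurrences-++ r (x ∷ xs) ys with r ≡ᵇ x
... | true = cong suc (occurrences-++ r xs ys)
... | false = occurrences-++ r xs ys

occurrences>0⇒∈ : ∀ {r} xs → 0 < occurrences r xs → r ∈ xs
occurrences>0⇒∈ {r} (x ∷ xs) pos with r ≡ᵇ x in eq
... | true = here (≡ᵇ-true⇒≡ eq)
... | false = there (occurrences>0⇒∈ xs pos)

∈⇒occurrences>0 : ∀ {r} xs → r ∈ xs → 0 < occurrences r xs
∈⇒occurrences>0 {r} (_ ∷ _) (here refl) rewrite ≡ᵇ-refl r = s≤s z≤n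
∈⇒occurrences>0 {r} (x ∷ xs) (there r∈xs) with r ≡ᵇ x
... | true = s≤s z≤n
... | false = ∈⇒occurrences>0 xs r∈xs

∉⇒occurrences≡0 : ∀ {r} xs → r ∉ xs → occurrences r xs ≡ 0
∉⇒occurrences≡0 {r} xs r∉xs with occurrences r xs in eq
... | zero = refl
... | suc _ = contradiction (occurrences>0⇒∈ xs (subst (0 <_) (sym eq) (s≤s z≤n))) r∉xs

occurrences-∷-cancel : ∀ r x xs ys →
  occurrences r (x ∷ xs) ≡ occurrences r (x ∷ ys) → occurrences r xs ≡ occurrences r ys
occurrences-∷-cancel r x xs ys eq with r ≡ᵇ x
... | true = suc-injective eq
... | false = eq

Descending : List ℕ → Set
Descending = AllPairs _≥_

descending-head-max : ∀ {x y ys} → Descending (y ∷ ys) → x ∈ y ∷ ys → x ≤ y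
descending-head-max _ (here refl) = ≤-refl
descending-head-max (y≥ys ∷ _) (there x∈ys) = All.lookup y≥ys x∈ys

descending-≡ : ∀ {xs ys} → Descending xs → Descending ys →
  (∀ r → occurrences r xs ≡ occurrences r ys) → xs ≡ ys
descending-≡ {[]} {[]} _ _ _ = refl
descending-≡ {[]} {y ∷ ys} _ _ same = contradiction (same y) (<⇒≢ (∈⇒occurrences>0 (y ∷ ys) (here refl)))
descending-≡ {x ∷ xs} {[]} _ _ same = contradiction (same x) (>⇒≢ (∈⇒occurrences>0 (x ∷ xs) (here refl)))
descending-≡ {x ∷ xs} {y ∷ ys} ↓xs ↓ys same =
  cong₂ _∷_ x≡y (descending-≡ (AllPairs.tail ↓xs) (AllPairs.tail ↓ys) same-tail)
  where
  x∈ys : x ∈ y ∷ ys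
  x∈ys = occurrences>0⇒∈ (y ∷ ys) (subst (0 <_) (same x) (∈⇒occurrences>0 (x ∷ xs) (here refl)))
  y∈xs : y ∈ x ∷ xs
  y∈xs = occurrences>0⇒∈ (x ∷ xs) (subst (0 <_) (sym (same y)) (∈⇒occurrences>0 (y ∷ ys) (here refl)))
  x≡y : x ≡ y
  x≡y = ≤-antisym (descending-head-max ↓ys x∈ys) (descending-head-max ↓xs y∈xs)
  same-tail : ∀ r → occurrences r xs ≡ occurrences r ys
  same-tail r = occurrences-∷-cancel r x xs ys (trans (same r) (cong (λ z → occurrences r (z ∷ ys)) (sym x≡y)))

∈-cellsRow⇒entry : ∀ {i c r j d} l → (i , c , r) ∈ cellsRow j d l → i ≡ j
∈-cellsRow⇒entry (_ ∷ _) (here refl) = refl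
∈-cellsRow⇒entry (_ ∷ l) (there m) = ∈-cellsRow⇒entry l m

∈-cellsRow⇒col≥ : ∀ {i c r j d} l → (i , c , r) ∈ cellsRow j d l → d ≤ c
∈-cellsRow⇒col≥ (_ ∷ _) (here refl) = ≤-refl
∈-cellsRow⇒col≥ (_ ∷ l) (there m) = <⇒≤ (∈-cellsRow⇒col≥ l m)

∈-cellsRow⇒col< : ∀ {i c r j d} l → (i , c , r) ∈ cellsRow j d l → c < d + length l
∈-cellsRow⇒col< {d = d} (_ ∷ l) (here refl) = <-≤-trans (s≤s (m≤m+n d (length l))) (≤-reflexive (sym (+-suc d (length l))))
∈-cellsRow⇒col< {d = d} (_ ∷ l) (there m) = <-≤-trans (∈-cellsRow⇒col< l m) (≤-reflexive (sym (+-suc d (length l))))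

cellsRow-functional : ∀ {i c r r' j d} l →
  (i , c , r) ∈ cellsRow j d l → (i , c , r') ∈ cellsRow j d l → r ≡ r'
cellsRow-functional (_ ∷ _) (here refl) (here refl) = refl
cellsRow-functional (_ ∷ l) (here refl) (there m) = contradiction (∈-cellsRow⇒col≥ l m) 1+n≰n
cellsRow-functional (_ ∷ l) (there m) (here refl) = contradiction (∈-cellsRow⇒col≥ l m) 1+n≰n
cellsRow-functional (_ ∷ l) (there m) (there m') = cellsRow-functional l m m'

∈-cellsRow⁺ : ∀ {y} j d l → y ∈ l → ∃[ c ] (d ≤ c × (j , c , y) ∈ cellsRow j d l)
∈-cellsRow⁺ j d (_ ∷ _) (here refl) = d , ≤-refl , here refl
∈-cellsRow⁺ j d (_ ∷ l) (there y∈l) with ∈-cellsRow⁺ j (suc d) l y∈l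
... | c , d<c , m = c , <⇒≤ d<c , there m

cellsRow-injective : ∀ {j d} x x' → length x ≡ length x' → cellsRow j d x ⊆ cellsRow j d x' → x ≡ x'
cellsRow-injective [] [] _ _ = refl
cellsRow-injective {j} {d} (y ∷ x) (y' ∷ x') same-length ⊆' =
  cong₂ _∷_ head-≡ (cellsRow-injective x x' (suc-injective same-length) tail-⊆)
  where
  head-≡ : y ≡ y'
  head-≡ with ⊆' (here refl)
  ... | here refl = refl
  ... | there m = contradiction (∈-cellsRow⇒col≥ x' m) 1+n≰n
  tail-⊆ : cellsRow j (suc d) x ⊆ cellsRow j (suc d) x'
  tail-⊆ m with ⊆' (there m)
  ... | here refl = contradiction (∈-cellsRow⇒col≥ x m) 1+n≰n
  ... | there m' = m'

∈-cellsFrom⇒entry≥ : ∀ {i c r} s T → (i , c , r) ∈ cellsFrom s T → s ≤ i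
∈-cellsFrom⇒entry≥ s (x ∷ T) m with ∈-++⁻ (cellsRow s 1 x) m
... | inj₁ m∈x = ≤-reflexive (sym (∈-cellsRow⇒entry x m∈x))
... | inj₂ m∈T = <⇒≤ (∈-cellsFrom⇒entry≥ (suc s) T m∈T)

∈-cellsFrom-∷⁻ : ∀ {i c r} s x T → (i , c , r) ∈ cellsFrom s (x ∷ T) →
  (i ≡ s × (i , c , r) ∈ cellsRow s 1 x) ⊎ (s < i × (i , c , r) ∈ cellsFrom (suc s) T)
∈-cellsFrom-∷⁻ s x T m with ∈-++⁻ (cellsRow s 1 x) m
... | inj₁ m∈x = inj₁ (∈-cellsRow⇒entry x m∈x , m∈x)
... | inj₂ m∈T = inj₂ (∈-cellsFrom⇒entry≥ (suc s) T m∈T , m∈T)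

∈-cellsFrom⇒entry< : ∀ {i c r} s T → (i , c , r) ∈ cellsFrom s T → i < s + length T
∈-cellsFrom⇒entry< s (x ∷ T) m with ∈-cellsFrom-∷⁻ s x T m
... | inj₁ (refl , _) = m<m+n s (s≤s z≤n)
... | inj₂ (_ , m∈T) = <-≤-trans (∈-cellsFrom⇒entry< (suc s) T m∈T) (≤-reflexive (sym (+-suc s (length T))))

∈-cellsFrom⇒col≥1 : ∀ {i c r} s T → (i , c , r) ∈ cellsFrom s T → 1 ≤ c
∈-cellsFrom⇒col≥1 s (x ∷ T) m with ∈-cellsFrom-∷⁻ s x T m
... | inj₁ (_ , m∈x) = ∈-cellsRow⇒col≥ x m∈x
... | inj₂ (_ , m∈T) = ∈-cellsFrom⇒col≥1 (suc s) T m∈T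

cellsFrom-functional : ∀ {i c r r'} s T →
  (i , c , r) ∈ cellsFrom s T → (i , c , r') ∈ cellsFrom s T → r ≡ r'
cellsFrom-functional s (x ∷ T) m m' with ∈-cellsFrom-∷⁻ s x T m | ∈-cellsFrom-∷⁻ s x T m'
... | inj₁ (_ , m∈x) | inj₁ (_ , m'∈x) = cellsRow-functional x m∈x m'∈x
... | inj₁ (refl , _) | inj₂ (s<s , _) = contradiction s<s (<-irrefl refl)
... | inj₂ (s<s , _) | inj₁ (refl , _) = contradiction s<s (<-irrefl refl)
... | inj₂ (_ , m∈T) | inj₂ (_ , m'∈T) = cellsFrom-functional (suc s) T m∈T m'∈T

∈-cellsFrom⇒firstColumn : ∀ {i c r} s T → (i , c , r) ∈ cellsFrom s T → ∃[ ρ ] ((i , 1 , ρ) ∈ cellsFrom s T)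
∈-cellsFrom⇒firstColumn s (x ∷ T) m with ∈-cellsFrom-∷⁻ s x T m
∈-cellsFrom⇒firstColumn s ((y ∷ _) ∷ T) m | inj₁ (refl , _) = y , here refl
∈-cellsFrom⇒firstColumn s (x ∷ T) m | inj₂ (_ , m∈T) with ∈-cellsFrom⇒firstColumn (suc s) T m∈T
... | ρ , m₁ = ρ , ∈-++⁺ʳ (cellsRow s 1 x) m₁

cellsRow-sameLength : ∀ {i c r j d} x x' → length x ≡ length x' →
  (i , c , r) ∈ cellsRow j d x → ∃[ r' ] ((i , c , r') ∈ cellsRow j d x')
cellsRow-sameLength (_ ∷ _) (y' ∷ _) _ (here refl) = y' , here refl
cellsRow-sameLength (_ ∷ x) (_ ∷ x') same-length (there m)
  with cellsRow-sameLength x x' (suc-injective same-length) m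
... | r' , m' = r' , there m'

cellsFrom-sameShape : ∀ {i c r} s T T' → map length T ≡ map length T' →
  (i , c , r) ∈ cellsFrom s T → ∃[ r' ] ((i , c , r') ∈ cellsFrom s T')
cellsFrom-sameShape s (x ∷ T) (x' ∷ T') same-shape m with ∈-cellsFrom-∷⁻ s x T m
... | inj₁ (_ , m∈x) with cellsRow-sameLength x x' (∷-injectiveˡ same-shape) m∈x
...   | r' , m' = r' , ∈-++⁺ˡ m'
cellsFrom-sameShape s (x ∷ T) (x' ∷ T') same-shape m | inj₂ (_ , m∈T)
  with cellsFrom-sameShape (suc s) T T' (∷-injectiveʳ same-shape) m∈T
... | r' , m' = r' , ∈-++⁺ʳ (cellsRow s 1 x') m'

cellsFrom-injective : ∀ s T T' → map length T ≡ map length T' → cellsFrom s T ⊆ cellsFrom s T' → T ≡ T'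
cellsFrom-injective s [] [] _ _ = refl
cellsFrom-injective s (x ∷ T) (x' ∷ T') same-shape ⊆' =
  cong₂ _∷_ (cellsRow-injective x x' (∷-injectiveˡ same-shape) head-⊆)
            (cellsFrom-injective (suc s) T T' (∷-injectiveʳ same-shape) tail-⊆)
  where
  head-⊆ : cellsRow s 1 x ⊆ cellsRow s 1 x'
  head-⊆ m with ∈-cellsFrom-∷⁻ s x' T' (⊆' (∈-++⁺ˡ m))
  ... | inj₁ (_ , m') = m'
  ... | inj₂ (s<s , _) rewrite ∈-cellsRow⇒entry x m = contradiction s<s (<-irrefl refl)
  tail-⊆ : cellsFrom (suc s) T ⊆ cellsFrom (suc s) T'
  tail-⊆ m with ∈-cellsFrom-∷⁻ s x' T' (⊆' (∈-++⁺ʳ (cellsRow s 1 x) m))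
  ... | inj₁ (refl , _) = contradiction (∈-cellsFrom⇒entry≥ (suc s) T m) 1+n≰n
  ... | inj₂ (_ , m') = m'

firstRows laterRows : Filling → List ℕ
firstRows = concatMap (take 1)
laterRows = concatMap (drop 1)

countRow-++ : ∀ r L M → countRow r (L ++ M) ≡ countRow r L + countRow r M
countRow-++ r [] M = refl
countRow-++ r ((_ , _ , s) ∷ L) M with r ≡ᵇ s
... | true = cong suc (countRow-++ r L M)
... | false = countRow-++ r L M

countRow-cellsRow : ∀ r j d l → countRow r (cellsRow j d l) ≡ occurrences r l
countRow-cellsRow r j d [] = refl
countRow-cellsRow r j d (y ∷ l) with r ≡ᵇ y
... | true = cong suc (countRow-cellsRow r j (suc d) l)
... | false = countRow-cellsRow r j (suc d) l

occurrences-take-drop : ∀ r n xs → occurrences r xs ≡ occurrences r (take n xs) + occurrences r (drop n xs)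
occurrences-take-drop r n xs =
  trans (cong (occurrences r) (sym (take++drop≡id n xs))) (occurrences-++ r (take n xs) (drop n xs))

countRow-cellsFrom : ∀ r s T →
  countRow r (cellsFrom s T) ≡ occurrences r (firstRows T) + occurrences r (laterRows T)
countRow-cellsFrom r s [] = refl
countRow-cellsFrom r s (x ∷ T) = begin
  countRow r (cellsRow s 1 x ++ cellsFrom (suc s) T)
    ≡⟨ countRow-++ r (cellsRow s 1 x) _ ⟩
  countRow r (cellsRow s 1 x) + countRow r (cellsFrom (suc s) T)
    ≡⟨ cong₂ _+_ (countRow-cellsRow r s 1 x) (countRow-cellsFrom r (suc s) T) ⟩
  occurrences r x + (occurrences r (firstRows T) + occurrences r (laterRows T))
    ≡⟨ cong (_+ _) (occurrences-take-drop r 1 x) ⟩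
  (occurrences r (take 1 x) + occurrences r (drop 1 x)) + (occurrences r (firstRows T) + occurrences r (laterRows T))
    ≡⟨ interchange (occurrences r (take 1 x)) _ _ _ ⟩
  (occurrences r (take 1 x) + occurrences r (firstRows T)) + (occurrences r (drop 1 x) + occurrences r (laterRows T))
    ≡⟨ cong₂ _+_ (occurrences-++ r (take 1 x) _) (occurrences-++ r (drop 1 x) _) ⟨
  occurrences r (firstRows (x ∷ T)) + occurrences r (laterRows (x ∷ T)) ∎
  where open ≡-Reasoning

∈-firstRows⁻ : ∀ {r} s T → r ∈ firstRows T → ∃[ i ] ((i , 1 , r) ∈ cellsFrom s T)
∈-firstRows⁻ s ([] ∷ T) r∈ = ∈-firstRows⁻ (suc s) T r∈
∈-firstRows⁻ s ((_ ∷ _) ∷ T) (here refl) = s , here refl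
∈-firstRows⁻ s (x@(_ ∷ _) ∷ T) (there r∈) with ∈-firstRows⁻ (suc s) T r∈
... | i , m = i , ∈-++⁺ʳ (cellsRow s 1 x) m

∈-firstRows⁺ : ∀ {i r} s T → (i , 1 , r) ∈ cellsFrom s T → r ∈ firstRows T
∈-firstRows⁺ s (x ∷ T) m with ∈-cellsFrom-∷⁻ s x T m
∈-firstRows⁺ s ((_ ∷ _) ∷ T) m | inj₁ (_ , here refl) = here refl
∈-firstRows⁺ s ((_ ∷ l) ∷ T) m | inj₁ (_ , there m∈l) = contradiction (∈-cellsRow⇒col≥ l m∈l) 1+n≰n
∈-firstRows⁺ s (x ∷ T) m | inj₂ (_ , m∈T) = ∈-++⁺ʳ (take 1 x) (∈-firstRows⁺ (suc s) T m∈T)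

∈-laterRows⁻ : ∀ {r} s T → r ∈ laterRows T → ∃[ i ] ∃[ c ] (2 ≤ c × (i , c , r) ∈ cellsFrom s T)
∈-laterRows⁻ s (x ∷ T) r∈ with ∈-++⁻ (drop 1 x) r∈
∈-laterRows⁻ s ((_ ∷ l) ∷ T) r∈ | inj₁ r∈l with ∈-cellsRow⁺ s 2 l r∈l
... | c , 2≤c , m = s , c , 2≤c , ∈-++⁺ˡ (there m)
∈-laterRows⁻ s (x ∷ T) r∈ | inj₂ r∈T with ∈-laterRows⁻ (suc s) T r∈T
... | i , c , 2≤c , m = i , c , 2≤c , ∈-++⁺ʳ (cellsRow s 1 x) m

DistinctEntries : List Cell → Set
DistinctEntries G = ∀ {i j c r} → (i , c , r) ∈ G → (j , c , r) ∈ G → i ≡ j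

firstRows-occurrences≤1 : ∀ r s T → DistinctEntries (cellsFrom s T) → occurrences r (firstRows T) ≤ 1
firstRows-occurrences≤1 r s [] _ = z≤n
firstRows-occurrences≤1 r s ([] ∷ T) distinct = firstRows-occurrences≤1 r (suc s) T distinct
firstRows-occurrences≤1 r s (x@(y ∷ _) ∷ T) distinct with r ≡ᵇ y in r≡ᵇy
... | false = firstRows-occurrences≤1 r (suc s) T
                (λ m m' → distinct (∈-++⁺ʳ (cellsRow s 1 x) m) (∈-++⁺ʳ (cellsRow s 1 x) m'))
... | true = s≤s (≤-reflexive (∉⇒occurrences≡0 (firstRows T) r∉))
  where
  r∉ : r ∉ firstRows T
  r∉ r∈ with ∈-firstRows⁻ (suc s) T r∈
  ... | j , j∈T = <-irrefl (distinct s∈ (∈-++⁺ʳ (cellsRow s 1 x) j∈T)) (∈-cellsFrom⇒entry≥ (suc s) T j∈T)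
    where
    s∈ : (s , 1 , r) ∈ cellsFrom s (x ∷ T)
    s∈ = subst (λ z → (s , 1 , z) ∈ cellsFrom s (x ∷ T)) (sym (≡ᵇ-true⇒≡ r≡ᵇy)) (here refl)

Descends : List Cell → Set
Descends G = ∀ {i c c' r r'} → (i , c , r) ∈ G → (i , c' , r') ∈ G → c < c' → r' ≤ r

cellsRow-descending : ∀ j d l → Descends (cellsRow j d l) → Descending l
cellsRow-descending j d [] _ = []
cellsRow-descending j d (y ∷ l) desc =
  All.tabulate head-max ∷ cellsRow-descending j (suc d) l (λ m m' → desc (there m) (there m'))
  where
  head-max : ∀ {y'} → y' ∈ l → y' ≤ y
  head-max y'∈l with ∈-cellsRow⁺ j (suc d) l y'∈l
  ... | c , d<c , m = desc (here refl) (there m) d<c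

longParts≡0⇒laterRows≡[] : ∀ T → longParts (map length T) ≡ 0 → laterRows T ≡ []
longParts≡0⇒laterRows≡[] [] _ = refl
longParts≡0⇒laterRows≡[] ([] ∷ T) none = longParts≡0⇒laterRows≡[] T none
longParts≡0⇒laterRows≡[] ((_ ∷ []) ∷ T) none = longParts≡0⇒laterRows≡[] T none

laterRows-descending : ∀ s T → longParts (map length T) ≤ 1 → Descends (cellsFrom s T) → Descending (laterRows T)
laterRows-descending s [] _ _ = []
laterRows-descending s ([] ∷ T) long desc = laterRows-descending (suc s) T long desc
laterRows-descending s (x@(_ ∷ []) ∷ T) long desc =
  laterRows-descending (suc s) T long (λ m m' → desc (∈-++⁺ʳ (cellsRow s 1 x) m) (∈-++⁺ʳ (cellsRow s 1 x) m'))
laterRows-descending s (x@(_ ∷ z ∷ zs) ∷ T) (s≤s none) desc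
  rewrite longParts≡0⇒laterRows≡[] T (n≤0⇒n≡0 none) | ++-identityʳ (z ∷ zs) =
  AllPairs.tail (cellsRow-descending s 1 x (λ m m' → desc (∈-++⁺ˡ m) (∈-++⁺ˡ m')))

laterCell⇒long : ∀ {i c r j} x → (i , c , r) ∈ cellsRow j 1 x → 2 ≤ c → isLong (length x) ≡ 1
laterCell⇒long (_ ∷ _ ∷ _) _ _ = refl
laterCell⇒long (_ ∷ []) (there ()) _
laterCell⇒long (_ ∷ []) (here refl) (s≤s ())

laterCell⇒longParts>0 : ∀ {i c r} s T → (i , c , r) ∈ cellsFrom s T → 2 ≤ c → 0 < longParts (map length T)
laterCell⇒longParts>0 s (x ∷ T) m 2≤c with ∈-cellsFrom-∷⁻ s x T m
... | inj₁ (_ , m∈x) = ≤-trans (≤-reflexive (sym (laterCell⇒long x m∈x 2≤c))) (m≤m+n _ _)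
... | inj₂ (_ , m∈T) = ≤-trans (laterCell⇒longParts>0 (suc s) T m∈T 2≤c) (m≤n+m _ _)

longRow-and-laterCell⇒longParts≥2 : ∀ {i c r j d r'} s x T →
  (i , c , r) ∈ cellsRow s 1 x → 2 ≤ c → (j , d , r') ∈ cellsFrom (suc s) T → 2 ≤ d →
  2 ≤ longParts (map length (x ∷ T))
longRow-and-laterCell⇒longParts≥2 s x T m∈x 2≤c m∈T 2≤d
  rewrite laterCell⇒long x m∈x 2≤c = s≤s (laterCell⇒longParts>0 (suc s) T m∈T 2≤d)

laterCells-sameEntry : ∀ {i c r j d r'} s T → longParts (map length T) ≤ 1 →
  (i , c , r) ∈ cellsFrom s T → 2 ≤ c → (j , d , r') ∈ cellsFrom s T → 2 ≤ d → i ≡ j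
laterCells-sameEntry s (x ∷ T) long m 2≤c m' 2≤d with ∈-cellsFrom-∷⁻ s x T m | ∈-cellsFrom-∷⁻ s x T m'
... | inj₁ (refl , _) | inj₁ (refl , _) = refl
... | inj₁ (_ , m∈x) | inj₂ (_ , m'∈T) =
  contradiction long (<⇒≱ (longRow-and-laterCell⇒longParts≥2 s x T m∈x 2≤c m'∈T 2≤d))
... | inj₂ (_ , m∈T) | inj₁ (_ , m'∈x) =
  contradiction long (<⇒≱ (longRow-and-laterCell⇒longParts≥2 s x T m'∈x 2≤d m∈T 2≤c))
... | inj₂ (_ , m∈T) | inj₂ (_ , m'∈T) =
  laterCells-sameEntry (suc s) T (≤-trans (m≤n+m _ _) long) m∈T 2≤c m'∈T 2≤d

++-injective : ∀ {A : Set} (xs xs' : List A) {ys ys'} → length xs ≡ length xs' →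
  xs ++ ys ≡ xs' ++ ys' → xs ≡ xs' × ys ≡ ys'
++-injective [] [] _ eq = refl , eq
++-injective (x ∷ xs) (x' ∷ xs') same-length eq
  with ∷-injective eq | ++-injective xs xs' (suc-injective same-length) (∷-injectiveʳ eq)
... | x≡x' , _ | xs≡xs' , ys≡ys' = cong₂ _∷_ x≡x' xs≡xs' , ys≡ys'

laterRows-injective : ∀ T T' → map length T ≡ map length T' →
  laterRows T ≡ laterRows T' → map (drop 1) T ≡ map (drop 1) T'
laterRows-injective [] [] _ _ = refl
laterRows-injective (x ∷ T) (x' ∷ T') same-shape eq =
  cong₂ _∷_ (proj₁ split) (laterRows-injective T T' (∷-injectiveʳ same-shape) (proj₂ split))
  where
  same-length : length (drop 1 x) ≡ length (drop 1 x')
  same-length = begin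
    length (drop 1 x)  ≡⟨ length-drop 1 x ⟩
    length x ∸ 1       ≡⟨ cong (_∸ 1) (∷-injectiveˡ same-shape) ⟩
    length x' ∸ 1      ≡⟨ length-drop 1 x' ⟨
    length (drop 1 x') ∎
    where open ≡-Reasoning
  split : drop 1 x ≡ drop 1 x' × laterRows T ≡ laterRows T'
  split = ++-injective (drop 1 x) (drop 1 x') same-length eq

laterCell-cellsRow-transfer : ∀ {i c r j} x x' → drop 1 x ≡ drop 1 x' →
  (i , c , r) ∈ cellsRow j 1 x → 2 ≤ c → (i , c , r) ∈ cellsRow j 1 x'
laterCell-cellsRow-transfer (_ ∷ _) _ _ (here refl) (s≤s ())
laterCell-cellsRow-transfer (_ ∷ _) (_ ∷ _) refl (there m) _ = there m
laterCell-cellsRow-transfer (_ ∷ _) [] refl (there ()) _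

laterCells-transfer : ∀ {i c r} s T T' → map (drop 1) T ≡ map (drop 1) T' →
  (i , c , r) ∈ cellsFrom s T → 2 ≤ c → (i , c , r) ∈ cellsFrom s T'
laterCells-transfer s (x ∷ T) (x' ∷ T') same-later m 2≤c with ∈-cellsFrom-∷⁻ s x T m
... | inj₁ (_ , m∈x) = ∈-++⁺ˡ (laterCell-cellsRow-transfer x x' (∷-injectiveˡ same-later) m∈x 2≤c)
... | inj₂ (_ , m∈T) =
  ∈-++⁺ʳ (cellsRow s 1 x') (laterCells-transfer (suc s) T T' (∷-injectiveʳ same-later) m∈T 2≤c)

m≡1⊓m+n : ∀ {m n} → m ≤ 1 → (0 < n → 0 < m) → m ≡ 1 ⊓ (m + n)
m≡1⊓m+n {zero} {zero} _ _ = refl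
m≡1⊓m+n {zero} {suc n} _ n>0⇒m>0 = contradiction (n>0⇒m>0 (s≤s z≤n)) λ ()
m≡1⊓m+n {suc zero} _ _ = refl
m≡1⊓m+n {suc (suc _)} (s≤s ()) _

countRow>0⇒∈ : ∀ r L → 0 < countRow r L → ∃[ i ] ∃[ c ] ((i , c , r) ∈ L)
countRow>0⇒∈ r ((i , c , s) ∷ L) pos with r ≡ᵇ s in r≡ᵇs
... | true = i , c , here (cong (λ z → i , c , z) (≡ᵇ-true⇒≡ r≡ᵇs))
... | false with countRow>0⇒∈ r L pos
...   | j , d , m = j , d , there m

countRow≡0 : ∀ r L → (∀ {i c} → (i , c , r) ∉ L) → countRow r L ≡ 0
countRow≡0 r L empty with countRow r L in eq
... | zero = refl
... | suc _ with countRow>0⇒∈ r L (subst (0 <_) (sym eq) (s≤s z≤n))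
...   | i , c , m = contradiction m empty

RowsWithin : ℕ → ℕ → List Cell → Set
RowsWithin s m L = ∀ {i c r} → (i , c , r) ∈ L → s ≤ r × r < s + m

wtFrom-≡⇒countRow-≡ : ∀ s m L L' → wtFrom s m L ≡ wtFrom s m L' →
  ∀ {r} → s ≤ r → r < s + m → countRow r L ≡ countRow r L'
wtFrom-≡⇒countRow-≡ s zero L L' _ s≤r r<s+0 =
  contradiction (<-≤-trans r<s+0 (≤-reflexive (+-identityʳ s))) (≤⇒≯ s≤r)
wtFrom-≡⇒countRow-≡ s (suc m) L L' eq {r} s≤r r<s+1+m with m≤n⇒m<n∨m≡n s≤r
... | inj₂ refl = ∷-injectiveˡ eq
... | inj₁ s<r = wtFrom-≡⇒countRow-≡ (suc s) m L L' (∷-injectiveʳ eq) s<r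
                   (<-≤-trans r<s+1+m (≤-reflexive (+-suc s m)))

wtFrom-≡⇒countRows-≡ : ∀ s m L L' → RowsWithin s m L → RowsWithin s m L' →
  wtFrom s m L ≡ wtFrom s m L' → ∀ r → countRow r L ≡ countRow r L'
wtFrom-≡⇒countRows-≡ s m L L' within within' eq r with s ≤? r | r <? s + m
... | yes s≤r | yes r<s+m = wtFrom-≡⇒countRow-≡ s m L L' eq s≤r r<s+m
... | no s≰r | _ = trans (countRow≡0 r L (s≰r ∘ proj₁ ∘ within)) (sym (countRow≡0 r L' (s≰r ∘ proj₁ ∘ within')))
... | _ | no r≮s+m = trans (countRow≡0 r L (r≮s+m ∘ proj₂ ∘ within)) (sym (countRow≡0 r L' (r≮s+m ∘ proj₂ ∘ within')))

module Kohnert = IsKohnertTableau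

module QuasiYamanouchiTableau {a T} (qy : IsQuasiYamanouchi a T) (long : longParts a ≤ 1) where
  open IsQuasiYamanouchi qy
  open Kohnert kohnert

  longRows : longParts (map length T) ≤ 1
  longRows = subst (λ b → longParts b ≤ 1) (sym shape) long

  rowsWithin : RowsWithin 1 (length a) (cells T)
  rowsWithin m = rowPos m , ≤-trans (s≤s (entryRow m)) (≤-trans (∈-cellsFrom⇒entry< 1 T m) (≤-reflexive length-T))
    where
    length-T : 1 + length T ≡ 1 + length a
    length-T = cong suc (trans (sym (length-map length T)) (cong length shape))

  descends-≤ : ∀ {i c c' r r'} → (i , c , r) ∈ cells T → (i , c' , r') ∈ cells T → c ≤ c' → r' ≤ r
  descends-≤ m m' c≤c' with m≤n⇒m<n∨m≡n c≤c'
  ... | inj₁ c<c' = descend m m' c<c'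
  ... | inj₂ refl = ≤-reflexive (cellsFrom-functional 1 T m' m)

  firstColumn-occupied : ∀ {i c r} → (i , c , r) ∈ cells T → ∃[ j ] ((j , 1 , r) ∈ cells T)
  firstColumn-occupied {r = r} m with condV m
  ... | inj₁ (c' , r∈r) with ∈-cellsFrom⇒firstColumn 1 T r∈r
  ...   | ρ , r∈ρ = r , subst (λ z → (r , 1 , z) ∈ cells T) ρ≡r r∈ρ
    where
    ρ≡r : ρ ≡ r
    ρ≡r = ≤-antisym (entryRow r∈ρ) (descends-≤ r∈ρ r∈r (∈-cellsFrom⇒col≥1 1 T r∈r))
  firstColumn-occupied m | inj₂ (j , zero , _ , _ , j∈ , _) = contradiction (∈-cellsFrom⇒col≥1 1 T j∈) λ ()
  firstColumn-occupied m | inj₂ (j , suc zero , _ , _ , j∈ , _) = j , j∈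
  firstColumn-occupied m | inj₂ (j , suc (suc d) , j' , d' , j∈ , j'∈ , d≤d')
    with laterCells-sameEntry 1 T longRows j∈ (s≤s (s≤s z≤n)) j'∈ (≤-trans (s≤s (s≤s z≤n)) d≤d')
  ... | refl = contradiction (descends-≤ j∈ j'∈ d≤d') 1+n≰n

  laterRows⇒firstRows : ∀ r → 0 < occurrences r (laterRows T) → 0 < occurrences r (firstRows T)
  laterRows⇒firstRows r pos with ∈-laterRows⁻ 1 T (occurrences>0⇒∈ (laterRows T) pos)
  ... | _ , _ , _ , m with firstColumn-occupied m
  ...   | _ , m₁ = ∈⇒occurrences>0 (firstRows T) (∈-firstRows⁺ 1 T m₁)

SameFirstColumnRow : Filling → Filling → ℕ → Set
SameFirstColumnRow T T' i = ∀ {r r'} → (i , 1 , r) ∈ cells T → (i , 1 , r') ∈ cells T' → r ≡ r'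

firstColumnRow-not-lower : ∀ {a T T' i ρ ρ'} → IsKohnertTableau a T → IsKohnertTableau a T' →
  (∀ {j r} → (j , 1 , r) ∈ cells T → ∃[ k ] ((k , 1 , r) ∈ cells T')) →
  (∀ {j c r} → 2 ≤ c → (j , c , r) ∈ cells T' → (j , c , r) ∈ cells T) →
  (∀ {j} → j < i → SameFirstColumnRow T T' j) →
  (i , 1 , ρ) ∈ cells T → (i , 1 , ρ') ∈ cells T' → ¬ ρ < ρ'
firstColumnRow-not-lower {T = T} {T'} {i} {ρ} K K' occupied later⇐ below i∈T i∈T' ρ<ρ' with occupied i∈T
... | j , j∈T' with <-cmp i j
...   | tri≈ _ refl _ = <-irrefl (cellsFrom-functional 1 T' j∈T' i∈T') ρ<ρ'
...   | tri> _ _ j<i with cellsFrom-sameShape 1 T' T (trans (Kohnert.shape K') (sym (Kohnert.shape K))) j∈T'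
...     | _ , j∈T = <-irrefl (sym (Kohnert.distinct K i∈T j∈T-ρ)) j<i
  where
  j∈T-ρ : (j , 1 , ρ) ∈ cells T
  j∈T-ρ = subst (λ z → (j , 1 , z) ∈ cells T) (below j<i j∈T j∈T') j∈T
firstColumnRow-not-lower K K' occupied later⇐ below i∈T i∈T' ρ<ρ' | j , j∈T' | tri< i<j _ _
  with Kohnert.condIV K' i∈T' j∈T' i<j ρ<ρ'
... | r , i∈T'₂ , ρ<r = <⇒≱ ρ<r (Kohnert.descend K i∈T (later⇐ (s≤s (s≤s z≤n)) i∈T'₂) (s≤s (s≤s z≤n)))

module SameWeight {a T T'} (qy : IsQuasiYamanouchi a T) (qy' : IsQuasiYamanouchi a T')
                  (long : longParts a ≤ 1) (same-wt : wt a T ≡ wt a T') where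
  private
    module Q = QuasiYamanouchiTableau qy long
    module Q' = QuasiYamanouchiTableau qy' long
    K = IsQuasiYamanouchi.kohnert qy
    K' = IsQuasiYamanouchi.kohnert qy'

  same-shape : map length T ≡ map length T'
  same-shape = trans (Kohnert.shape K) (sym (Kohnert.shape K'))

  same-occurrences : ∀ r → occurrences r (firstRows T) ≡ occurrences r (firstRows T')
                         × occurrences r (laterRows T) ≡ occurrences r (laterRows T')
  same-occurrences r = same-first , +-cancelˡ-≡ F L L' (trans same-sum (cong (_+ L') (sym same-first)))
    where
    F L F' L' : ℕ
    F = occurrences r (firstRows T)
    L = occurrences r (laterRows T)
    F' = occurrences r (firstRows T')
    L' = occurrences r (laterRows T')
    open ≡-Reasoning
    same-sum : F + L ≡ F' + L'
    same-sum = begin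
      F + L                    ≡⟨ countRow-cellsFrom r 1 T ⟨
      countRow r (cells T)     ≡⟨ wtFrom-≡⇒countRows-≡ 1 (length a) (cells T) (cells T') Q.rowsWithin Q'.rowsWithin same-wt r ⟩
      countRow r (cells T')    ≡⟨ countRow-cellsFrom r 1 T' ⟩
      F' + L'                  ∎
    same-first : F ≡ F'
    same-first = begin
      F              ≡⟨ m≡1⊓m+n (firstRows-occurrences≤1 r 1 T (Kohnert.distinct K)) (Q.laterRows⇒firstRows r) ⟩
      1 ⊓ (F + L)    ≡⟨ cong (1 ⊓_) same-sum ⟩
      1 ⊓ (F' + L')  ≡⟨ m≡1⊓m+n (firstRows-occurrences≤1 r 1 T' (Kohnert.distinct K')) (Q'.laterRows⇒firstRows r) ⟨
      F'             ∎

  same-laterRows : map (drop 1) T ≡ map (drop 1) T'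
  same-laterRows = laterRows-injective T T' same-shape
    (descending-≡ (laterRows-descending 1 T Q.longRows (Kohnert.descend K))
                  (laterRows-descending 1 T' Q'.longRows (Kohnert.descend K'))
                  (proj₂ ∘ same-occurrences))

  laterCells⇒ : ∀ {i c r} → 2 ≤ c → (i , c , r) ∈ cells T → (i , c , r) ∈ cells T'
  laterCells⇒ 2≤c m = laterCells-transfer 1 T T' same-laterRows m 2≤c

  laterCells⇐ : ∀ {i c r} → 2 ≤ c → (i , c , r) ∈ cells T' → (i , c , r) ∈ cells T
  laterCells⇐ 2≤c m = laterCells-transfer 1 T' T (sym same-laterRows) m 2≤c

  firstColumn-occupied⇒ : ∀ {i r} → (i , 1 , r) ∈ cells T → ∃[ j ] ((j , 1 , r) ∈ cells T')
  firstColumn-occupied⇒ {r = r} m = ∈-firstRows⁻ 1 T' (occurrences>0⇒∈ (firstRows T')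
    (subst (0 <_) (proj₁ (same-occurrences r)) (∈⇒occurrences>0 (firstRows T) (∈-firstRows⁺ 1 T m))))

  firstColumn-occupied⇐ : ∀ {i r} → (i , 1 , r) ∈ cells T' → ∃[ j ] ((j , 1 , r) ∈ cells T)
  firstColumn-occupied⇐ {r = r} m = ∈-firstRows⁻ 1 T (occurrences>0⇒∈ (firstRows T)
    (subst (0 <_) (sym (proj₁ (same-occurrences r))) (∈⇒occurrences>0 (firstRows T') (∈-firstRows⁺ 1 T' m))))

  sameFirstColumnRows : ∀ i → SameFirstColumnRow T T' i
  sameFirstColumnRows = <-rec (SameFirstColumnRow T T') step
    where
    step : ∀ i → (∀ {j} → j < i → SameFirstColumnRow T T' j) → SameFirstColumnRow T T' i
    step i below {r} {r'} i∈T i∈T' with <-cmp r r'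
    ... | tri≈ _ r≡r' _ = r≡r'
    ... | tri< r<r' _ _ =
      contradiction r<r' (firstColumnRow-not-lower K K' firstColumn-occupied⇒ laterCells⇐ below i∈T i∈T')
    ... | tri> _ _ r'<r =
      contradiction r'<r (firstColumnRow-not-lower K' K firstColumn-occupied⇐ laterCells⇒
                            (λ j<i j∈T' j∈T → sym (below j<i j∈T j∈T')) i∈T' i∈T)

  cells⊆ : cells T ⊆ cells T'
  cells⊆ {i , zero , r} m = contradiction (∈-cellsFrom⇒col≥1 1 T m) λ ()
  cells⊆ {i , suc zero , r} m with cellsFrom-sameShape 1 T T' same-shape m
  ... | r' , m' = subst (λ z → (i , 1 , z) ∈ cells T') (sym (sameFirstColumnRows i m m')) m'
  cells⊆ {i , suc (suc _) , r} m = laterCells⇒ (s≤s (s≤s z≤n)) m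

atMostOneLongPart⇒multiplicityFree : ∀ a → longParts a ≤ 1 → MultiplicityFree a
atMostOneLongPart⇒multiplicityFree a long T T' qy qy' same-wt =
  cellsFrom-injective 1 T T' same-shape cells⊆
  where open SameWeight qy qy' long same-wt

corollary5p3 : (a : WeakComp) (n k : ℕ) → 1 ≤ n → k < n →
               sortWC a ≡ hook n k → MultiplicityFree a
corollary5p3 a n k _ _ sorted = atMostOneLongPart⇒multiplicityFree a (sortWC≡hook⇒longParts≤1 a n k sorted)
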